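{- Let $X,Y,Z\subseteq U$ and let $p$ be a complete pattern over $U$. Let $p_0=p\cup\{X\cup Y,Z\}$, $p_1=p\cup\{Y\cup Z,X\}$, $p_2=p\cup\{X\cup Z,Y\}$. Then $\{p_1,p_2\}$ jointly dominates $p_0$ over all patterns: for every pattern $r$ over $U$ with $p_0\sim r$, we have $p_1\sim r$ or $p_2\sim r$.
   Context: Let $U$ be a finite totally ordered set and $0\notin U$. A pattern over $U$ is a set $p$ of subsets of $U\cup\{0\}$ such that exactly one member of $p$ contains $0$. Let $\mathrm{lbs}(p)=\bigcup_{S\in p}S\setminus\{0\}$ and $\mathrm{sing}(p)=\{u\in U:\{u\}\in p\}$; $p$ is complete if $\mathrm{lbs}(p)=\mathrm{sing}(p)$. For patterns $p,q$, the join $p\sqcup q$ is obtained by relating $S\in p$ and $T\in q$ whenever $S\cap T\neq\emptyset$, taking the equivalence closure on the members of $p$ and $q$, and forming the union of the members of each class. Patterns $p,q$ are consistent, $p\sim q$, if $p\sqcup q$ consists of a single set. -}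

module Defs where

-- U is modelled as Fin n (a finite totally ordered set); U ∪ {0} is
-- Fin (suc n), where the new element 0 is `zero` and u ∈ U is `suc u`.

open import Data.Nat using (ℕ; suc)
open import Data.Bool using (Bool; true; false; _∨_)
import Data.Bool.Properties as BoolP
open import Data.Fin using (Fin; zero; suc)
open import Data.Fin.Subset using (Subset; _∈_; _∪_; ⁅_⁆)
open import Data.Vec using (_∷_)
open import Data.Vec.Properties using (≡-dec)
open import Data.Product using (Σ; ∃; _×_; _,_)
open import Data.Sum using (_⊎_; inj₁; inj₂)
open import Data.Empty using (⊥)
open import Data.Unit using (⊤)
open import Function.Bundles using (_⇔_)
open import Relation.Nullary.Decidable using (⌊_⌋)
open import Relation.Binary.PropositionalEquality using (_≡_)
open import Relation.Binary.Construct.Closure.Equivalence using (EqClosure)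

Family : ℕ → Set
Family n = Subset (suc n) → Bool

_∈F_ : ∀ {n} → Subset (suc n) → Family n → Set
S ∈F p = p S ≡ true

𝟘 : ∀ {n} → Fin (suc n)
𝟘 = zero

emb : ∀ {n} → Subset n → Subset (suc n)
emb X = false ∷ X

IsPattern : ∀ {n} → Family n → Set
IsPattern p = Σ _ λ S → S ∈F p × 𝟘 ∈ S × (∀ S' → S' ∈F p → 𝟘 ∈ S' → S' ≡ S)

_∈lbs_ : ∀ {n} → Fin n → Family n → Set
u ∈lbs p = ∃ λ S → S ∈F p × suc u ∈ S

_∈sing_ : ∀ {n} → Fin n → Family n → Set
u ∈sing p = ⁅ suc u ⁆ ∈F p

IsComplete : ∀ {n} → Family n → Set
IsComplete p = ∀ u → (u ∈lbs p) ⇔ (u ∈sing p)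

add2 : ∀ {n} → Family n → Subset (suc n) → Subset (suc n) → Family n
add2 p A B S = p S ∨ ⌊ ≡-dec BoolP._≟_ S A ⌋ ∨ ⌊ ≡-dec BoolP._≟_ S B ⌋

Member : ∀ {n} → Family n → Family n → Set
Member p q = (Σ _ λ S → S ∈F p) ⊎ (Σ _ λ T → T ∈F q)

setOf : ∀ {n} {p q : Family n} → Member p q → Subset (suc n)
setOf (inj₁ (S , _)) = S
setOf (inj₂ (T , _)) = T

Rel : ∀ {n} {p q : Family n} → Member p q → Member p q → Set
Rel (inj₁ (S , _)) (inj₂ (T , _)) = ∃ λ x → x ∈ S × x ∈ T
Rel _ _ = ⊥

Conn : ∀ {n} {p q : Family n} → Member p q → Member p q → Set
Conn {p = p} {q} = EqClosure (Rel {p = p} {q})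

_∈Join_,_ : ∀ {n} → Subset (suc n) → Family n → Family n → Set
T ∈Join p , q = ∃ λ (A : Member p q) →
  ∀ x → (x ∈ T) ⇔ (∃ λ B → Conn A B × x ∈ setOf B)

_∼_ : ∀ {n} → Family n → Family n → Set
p ∼ q = Σ _ λ T → (T ∈Join p , q) × (∀ T' → T' ∈Join p , q → T' ≡ T)

{-# OPTIONS --safe #-}
module Submission where

-- Since p₀ and r both have a member containing 0, p₀ ∼ r says exactly that the
-- bipartite intersection graph of p₀ and r is connected. Walking in it from Z to
-- X ∪ Y, the last stretch after leaving Z gives members R₁ ∋ x with x ∈ X ∪ Y and
-- R₂ meeting Z, joined through members of p alone. If x ∈ X, then in p₁ the
-- members X and Y ∪ Z are joined through R₁ … R₂, and every member of r that met
-- X ∪ Y or Z meets X or Y ∪ Z, so p₁ ∼ r; symmetrically p₂ ∼ r if x ∈ Y.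

open import Defs
open import Data.Nat using (ℕ; zero; suc)
open import Data.Bool using (Bool; true; false; _∨_)
import Data.Bool.Properties as Bool
open import Data.Bool.Properties using (∨-zeroʳ)
open import Data.Fin using (Fin; zero; suc)
open import Data.Fin.Properties using (any?)
open import Data.Fin.Subset using (Subset; _∪_; _∈_; _⊆_; inside; outside)
open import Data.Fin.Subset.Properties using (_∈?_; ⊆-antisym; x∈p∪q⁻; p⊆p∪q; q⊆p∪q)
open import Data.Vec using ([]; _∷_; here; there)
import Data.Vec.Properties as Vec
open import Data.List using (List; []; _∷_; _++_; map)
import Data.List.Membership.Propositional as List
open import Data.List.Membership.Propositional.Properties using (∈-++⁺ˡ; ∈-++⁺ʳ; ∈-map⁺)
import Data.List.Relation.Unary.Any as Any
open import Data.Product using (Σ; ∃; _×_; _,_; proj₁; proj₂; map₂)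
open import Data.Product.Properties using () renaming (≡-dec to Σ-≡-dec)
open import Data.Sum using (_⊎_; inj₁; inj₂; [_,_]; map₁; swap; reduce; fromInj₁) renaming (map to ⊎-map)
open import Data.Sum.Properties using () renaming (≡-dec to ⊎-≡-dec)
open import Data.Empty using (⊥; ⊥-elim)
open import Function using (_∘_)
open import Function.Bundles using (_⇔_; mk⇔; Equivalence)
open import Relation.Nullary using (Dec; yes; no; does; contradiction)
open import Relation.Nullary.Decidable using (_⊎-dec_; _×-dec_; map′)
open import Relation.Unary using (Decidable)
open import Relation.Binary.PropositionalEquality using (_≡_; refl; sym; trans; cong; subst)
open import Relation.Binary.Definitions using (DecidableEquality)
open import Relation.Binary.Construct.Closure.ReflexiveTransitive using (Star; ε; _◅_; _◅◅_)
open import Relation.Binary.Construct.Closure.Symmetric using (SymClosure; fwd; bwd)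
import Relation.Binary.Construct.Closure.Equivalence as EqClosure
open import Axiom.UniquenessOfIdentityProofs using (module Decidable⇒UIP)

module FiniteReachability {V : Set} (_≟_ : DecidableEquality V)
                          {E : V → V → Set} (E? : ∀ u v → Dec (E u v)) where

  -- Floyd–Warshall: Via ws u v is a path from u to v whose intermediate
  -- vertices all lie in ws.
  Via : List V → V → V → Set
  Via []       u v = u ≡ v ⊎ E u v
  Via (w ∷ ws) u v = Via ws u v ⊎ (Via ws u w × Via ws w v)

  via? : ∀ ws u v → Dec (Via ws u v)
  via? []       u v = (u ≟ v) ⊎-dec E? u v
  via? (w ∷ ws) u v = via? ws u v ⊎-dec (via? ws u w ×-dec via? ws w v)

  via⇒star : ∀ ws {u v} → Via ws u v → Star E u v
  via⇒star []       (inj₁ refl)        = ε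
  via⇒star []       (inj₂ e)           = e ◅ ε
  via⇒star (w ∷ ws) (inj₁ uv)          = via⇒star ws uv
  via⇒star (w ∷ ws) (inj₂ (uw , wv))   = via⇒star ws uw ◅◅ via⇒star ws wv

  via-weaken : ∀ ws {u v} → Via [] u v → Via ws u v
  via-weaken []       uv = uv
  via-weaken (w ∷ ws) uv = inj₁ (via-weaken ws uv)

  via-trans : ∀ ws {u w v} → w List.∈ ws → Via ws u w → Via ws w v → Via ws u v
  via-trans (w ∷ ws) (Any.here refl) uw wv = inj₂ (avoid-target uw , avoid-source wv)
    where
    avoid-target : ∀ {u} → Via (w ∷ ws) u w → Via ws u w
    avoid-target (inj₁ uw)       = uw
    avoid-target (inj₂ (uw , _)) = uw
    avoid-source : ∀ {v} → Via (w ∷ ws) w v → Via ws w v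
    avoid-source (inj₁ wv)       = wv
    avoid-source (inj₂ (_ , wv)) = wv
  via-trans (_ ∷ ws) (Any.there w∈) (inj₁ uw) (inj₁ wv) = inj₁ (via-trans ws w∈ uw wv)
  via-trans (_ ∷ ws) (Any.there w∈) (inj₁ uw) (inj₂ (wx , xv)) = inj₂ (via-trans ws w∈ uw wx , xv)
  via-trans (_ ∷ ws) (Any.there w∈) (inj₂ (ux , xw)) (inj₁ wv) = inj₂ (ux , via-trans ws w∈ xw wv)
  via-trans (_ ∷ ws) (Any.there w∈) (inj₂ (ux , _)) (inj₂ (_ , xv)) = inj₂ (ux , xv)

  module _ (vs : List V) (∈-vs : ∀ v → v List.∈ vs) where

    star⇒via : ∀ {u v} → Star E u v → Via vs u v
    star⇒via ε                 = via-weaken vs (inj₁ refl)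
    star⇒via (_◅_ {j = w} e p) = via-trans vs (∈-vs w) (via-weaken vs (inj₂ e)) (star⇒via p)

    star? : ∀ u v → Dec (Star E u v)
    star? u v = map′ (via⇒star vs) star⇒via (via? vs u v)

allSubsets : ∀ m → List (Subset m)
allSubsets zero    = [] ∷ []
allSubsets (suc m) = map (inside ∷_) (allSubsets m) ++ map (outside ∷_) (allSubsets m)

∈-allSubsets : ∀ {m} (S : Subset m) → S List.∈ allSubsets m
∈-allSubsets []              = Any.here refl
∈-allSubsets (true  ∷ S)     = ∈-++⁺ˡ (∈-map⁺ (inside ∷_) (∈-allSubsets S))
∈-allSubsets {suc m} (false ∷ S) =
  ∈-++⁺ʳ (map (inside ∷_) (allSubsets m)) (∈-map⁺ (outside ∷_) (∈-allSubsets S))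

subsetOf : ∀ {m} {P : Fin m → Set} → Decidable P → Subset m
subsetOf {zero}  P? = []
subsetOf {suc m} P? = does (P? zero) ∷ subsetOf (P? ∘ suc)

∈-subsetOf : ∀ {m} {P : Fin m → Set} (P? : Decidable P) {x} → x ∈ subsetOf P? ⇔ P x
∈-subsetOf P? {x} = mk⇔ (to P? x) (from P? x)
  where
  to : ∀ {m} {P : Fin m → Set} (P? : Decidable P) x → x ∈ subsetOf P? → P x
  to P? zero    x∈ with P? zero
  ... | yes Px = Px
  to P? zero    () | no _
  to P? (suc x) (there x∈) = to (P? ∘ suc) x x∈
  from : ∀ {m} {P : Fin m → Set} (P? : Decidable P) x → P x → x ∈ subsetOf P?
  from P? zero    Px with P? zero
  ... | yes _  = here
  ... | no ¬Px = ⊥-elim (¬Px Px)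
  from P? (suc x) Px = there (from (P? ∘ suc) x Px)

Meets : ∀ {m} → Subset m → Subset m → Set
Meets A B = ∃ λ x → x ∈ A × x ∈ B

meets? : ∀ {m} (A B : Subset m) → Dec (Meets A B)
meets? A B = any? (λ x → (x ∈? A) ×-dec (x ∈? B))

module _ {n : ℕ} where

  Mem : Family n → Set
  Mem q = Σ (Subset (suc n)) (_∈F q)

  ≡true-irrelevant : ∀ {b : Bool} (e e′ : b ≡ true) → e ≡ e′
  ≡true-irrelevant = Decidable⇒UIP.≡-irrelevant Bool._≟_

  _≟ₛ_ : DecidableEquality (Subset (suc n))
  _≟ₛ_ = Vec.≡-dec Bool._≟_

  members : (q : Family n) → List (Subset (suc n)) → List (Mem q)
  members q []       = []
  members q (S ∷ Ss) with q S Bool.≟ true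
  ... | yes e = (S , e) ∷ members q Ss
  ... | no _  = members q Ss

  ∈-members : ∀ {q} Ss {S} (e : S ∈F q) → S List.∈ Ss → (S , e) List.∈ members q Ss
  ∈-members {q} (S ∷ Ss) e (Any.here refl) with q S Bool.≟ true
  ... | yes e′ = Any.here (cong (S ,_) (≡true-irrelevant e e′))
  ... | no ¬e  = ⊥-elim (¬e e)
  ∈-members {q} (S′ ∷ Ss) e (Any.there S∈) with q S′ Bool.≟ true
  ... | yes _ = Any.there (∈-members Ss e S∈)
  ... | no _  = ∈-members Ss e S∈

  Connected : (q r : Family n) → Member q r → Member q r → Set
  Connected q r = Conn {p = q} {r}

  module IntersectionGraph (q r : Family n) where

    Node : Set
    Node = Member q r

    nodes : List Node
    nodes = map inj₁ (members q (allSubsets _)) ++ map inj₂ (members r (allSubsets _))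

    ∈-nodes : ∀ a → a List.∈ nodes
    ∈-nodes (inj₁ (S , e)) = ∈-++⁺ˡ (∈-map⁺ inj₁ (∈-members _ e (∈-allSubsets S)))
    ∈-nodes (inj₂ (S , e)) =
      ∈-++⁺ʳ (map inj₁ (members q (allSubsets _))) (∈-map⁺ inj₂ (∈-members _ e (∈-allSubsets S)))

    _≟_ : DecidableEquality Node
    _≟_ = ⊎-≡-dec mem-≟ mem-≟
      where
      mem-≟ : ∀ {f : Family n} → DecidableEquality (Mem f)
      mem-≟ = Σ-≡-dec _≟ₛ_ (λ e e′ → yes (≡true-irrelevant e e′))

    any-node? : ∀ {P : Node → Set} → Decidable P → Dec (∃ P)
    any-node? P? = map′ Any.satisfied (λ (a , Pa) → List.lose (∈-nodes a) Pa) (Any.any? P? nodes)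

    rel? : ∀ a b → Dec (Rel {p = q} {r} a b)
    rel? (inj₁ (S , _)) (inj₂ (T , _)) = meets? S T
    rel? (inj₁ _)       (inj₁ _)       = no λ ()
    rel? (inj₂ _)       (inj₁ _)       = no λ ()
    rel? (inj₂ _)       (inj₂ _)       = no λ ()

    edge? : ∀ a b → Dec (SymClosure (Rel {p = q} {r}) a b)
    edge? a b = map′ [ fwd , bwd ] (λ { (fwd e) → inj₁ e ; (bwd e) → inj₂ e }) (rel? a b ⊎-dec rel? b a)

    connected? : ∀ a b → Dec (Connected q r a b)
    connected? = FiniteReachability.star? _≟_ edge? nodes ∈-nodes

    InComponent : Node → Fin (suc n) → Set
    InComponent a x = ∃ λ b → Connected q r a b × x ∈ setOf b

    inComponent? : ∀ a → Decidable (InComponent a)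
    inComponent? a x = any-node? (λ b → connected? a b ×-dec x ∈? setOf b)

    component : Node → Subset (suc n)
    component a = subsetOf (inComponent? a)

    ∈-component : ∀ a {x} → x ∈ component a ⇔ InComponent a x
    ∈-component a = ∈-subsetOf (inComponent? a)

    component-∈Join : ∀ a → component a ∈Join q , r
    component-∈Join a = a , λ x → ∈-component a

  module _ {q r : Family n} where
    open IntersectionGraph q r

    connected⇒∼ : (a₀ : Member q r) → (∀ a → Connected q r a a₀) → q ∼ r
    connected⇒∼ a₀ conn = component a₀ , component-∈Join a₀ , unique
      where
      unique : ∀ T → T ∈Join q , r → T ≡ component a₀
      unique T (a , T≈) = ⊆-antisym T⊆ ⊆T
        where
        T⊆ : T ⊆ component a₀
        T⊆ x∈T with Equivalence.to (T≈ _) x∈T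
        ... | b , a~b , x∈b =
          Equivalence.from (∈-component a₀) (b , EqClosure.symmetric _ (conn a) ◅◅ a~b , x∈b)
        ⊆T : component a₀ ⊆ T
        ⊆T x∈C with Equivalence.to (∈-component a₀) x∈C
        ... | b , a₀~b , x∈b = Equivalence.from (T≈ _) (b , conn a ◅◅ a₀~b , x∈b)

    -- A point shared by a member of q and a member of r lies in the single join
    -- set, hence in the component of every node.
    ∼⇒connected : ∀ {S₀ R₀ x} → S₀ ∈F q → (R₀∈r : R₀ ∈F r) → x ∈ S₀ → x ∈ R₀ →
                  q ∼ r → ∀ a → Connected q r a (inj₂ (R₀ , R₀∈r))
    ∼⇒connected {S₀} {R₀} {x} S₀∈q R₀∈r x∈S₀ x∈R₀ (T , _ , unique) a =
      let (b , a~b , x∈b) = Equivalence.to (∈-component a) x∈component-a in a~b ◅◅ through-x b x∈b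
      where
      a₀ : Member q r
      a₀ = inj₂ (R₀ , R₀∈r)
      same-component : component a₀ ≡ component a
      same-component = trans (unique _ (component-∈Join a₀)) (sym (unique _ (component-∈Join a)))
      x∈component-a : x ∈ component a
      x∈component-a = subst (x ∈_) same-component (Equivalence.from (∈-component a₀) (a₀ , ε , x∈R₀))
      through-x : ∀ b → x ∈ setOf b → Connected q r b a₀
      through-x (inj₁ _) x∈S = fwd (x , x∈S , x∈R₀) ◅ ε
      through-x (inj₂ _) x∈R =
        _◅_ {j = inj₁ (S₀ , S₀∈q)} (bwd (x , x∈S₀ , x∈R)) (fwd (x , x∈S₀ , x∈R₀) ◅ ε)

  module _ {p : Family n} {A B : Subset (suc n)} where

    ⊆-add2 : ∀ {S} → S ∈F p → S ∈F add2 p A B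
    ⊆-add2 S∈p = cong (_∨ _) S∈p

    ∈-add2-A : A ∈F add2 p A B
    ∈-add2-A with A ≟ₛ A
    ... | yes _  = ∨-zeroʳ (p A)
    ... | no A≢A = contradiction refl A≢A

    ∈-add2-B : B ∈F add2 p A B
    ∈-add2-B with B ≟ₛ B
    ... | yes _  = trans (cong (p B ∨_) (∨-zeroʳ _)) (∨-zeroʳ (p B))
    ... | no B≢B = contradiction refl B≢B

    ∈-add2⁻ : ∀ {S} → S ∈F add2 p A B → S ∈F p ⊎ S ≡ A ⊎ S ≡ B
    ∈-add2⁻ {S} S∈ with p S | S ≟ₛ A | S ≟ₛ B
    ... | true  | _       | _       = inj₁ refl
    ... | false | yes S≡A | _       = inj₂ (inj₁ S≡A)
    ... | false | no _    | yes S≡B = inj₂ (inj₂ S≡B)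

  module _ {q q′ r : Family n} (q⊆q′ : ∀ {S} → S ∈F q → S ∈F q′) where

    widen : Member q r → Member q′ r
    widen = map₁ (map₂ q⊆q′)

    Connected-widen : ∀ {a b} → Connected q r a b → Connected q′ r (widen a) (widen b)
    Connected-widen = EqClosure.gmap widen rel-widen
      where
      rel-widen : ∀ {a b} → Rel {p = q} {r} a b → Rel {p = q′} {r} (widen a) (widen b)
      rel-widen {inj₁ _} {inj₂ _} S∩R = S∩R
      rel-widen {inj₁ _} {inj₁ _} ()
      rel-widen {inj₂ _} {inj₁ _} ()
      rel-widen {inj₂ _} {inj₂ _} ()

  neighbour : ∀ {q r : Family n} {S S∈q} {R : Mem r} →
              Connected q r (inj₁ (S , S∈q)) (inj₂ R) → ∃ λ (R′ : Mem r) → Meets S (proj₁ R′)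
  neighbour (_◅_ {j = inj₂ R′} (fwd S∩R′) _) = R′ , S∩R′
  neighbour (_◅_ {j = inj₁ _}  (fwd ())   _)
  neighbour (_◅_ {j = inj₁ _}  (bwd ())   _)
  neighbour (_◅_ {j = inj₂ _}  (bwd ())   _)

  module Propagation {q r : Family n} (Good : Mem r → Set) {Done : Set}
                     (step : ∀ {S R R′} → S ∈F q → Meets S (proj₁ R) → Meets S (proj₁ R′) →
                             Good R → Good R′ ⊎ Done) where

    GoodNode : Member q r → Set
    GoodNode (inj₁ (S , _)) = ∃ λ R → Meets S (proj₁ R) × Good R
    GoodNode (inj₂ R)       = Good R

    propagate-edge : ∀ {a b} → SymClosure (Rel {p = q} {r}) a b → GoodNode a → GoodNode b ⊎ Done
    propagate-edge {inj₁ (S , S∈q)} {inj₂ R} (fwd S∩R) (R′ , S∩R′ , g) = step S∈q S∩R′ S∩R g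
    propagate-edge {inj₂ R} {inj₁ _} (bwd S∩R) g = inj₁ (R , S∩R , g)
    propagate-edge {inj₁ _} {inj₁ _} (fwd ())
    propagate-edge {inj₁ _} {inj₁ _} (bwd ())
    propagate-edge {inj₂ _} {inj₂ _} (fwd ())
    propagate-edge {inj₂ _} {inj₂ _} (bwd ())
    propagate-edge {inj₁ _} {inj₂ _} (bwd ())
    propagate-edge {inj₂ _} {inj₁ _} (fwd ())

    propagate : ∀ {a b} → Connected q r a b → GoodNode a → GoodNode b ⊎ Done
    propagate ε          g = inj₁ g
    propagate (e ◅ path) g = [ propagate path , inj₂ ] (propagate-edge e g)

  Bridge : (p r : Family n) (W Z : Subset (suc n)) → Set
  Bridge p r W Z = ∃ λ (R₁ : Mem r) → Meets W (proj₁ R₁) ×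
                   ∃ λ (R₂ : Mem r) → Meets Z (proj₁ R₂) × Connected p r (inj₂ R₁) (inj₂ R₂)

  Bridge-split : ∀ {p r : Family n} {W A B Z} → (∀ {x} → x ∈ W → x ∈ A ⊎ x ∈ B) →
                 Bridge p r W Z → Bridge p r A Z ⊎ Bridge p r B Z
  Bridge-split W⊆A∪B (R₁ , (x , x∈W , x∈R₁) , rest) with W⊆A∪B x∈W
  ... | inj₁ x∈A = inj₁ (R₁ , (x , x∈A , x∈R₁) , rest)
  ... | inj₂ x∈B = inj₂ (R₁ , (x , x∈B , x∈R₁) , rest)

  -- Walk from a neighbour of Z to W, restarting the bridge whenever the path passes Z.
  bridge : ∀ {p r : Family n} {W Z} (R₀ : Mem r) → (∀ a → Connected (add2 p W Z) r a (inj₂ R₀)) →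
           Bridge p r W Z
  bridge {p} {r} {W} {Z} R₀ connected₀ = reduce (propagate R~W (R , Z∩R , ε))
    where
    LinkedToZ : Mem r → Set
    LinkedToZ R₁ = ∃ λ R₂ → Meets Z (proj₁ R₂) × Connected p r (inj₂ R₁) (inj₂ R₂)

    step : ∀ {S R R′} → S ∈F add2 p W Z → Meets S (proj₁ R) → Meets S (proj₁ R′) →
           LinkedToZ R → LinkedToZ R′ ⊎ Bridge p r W Z
    step {S} {R} {R′} S∈ S∩R S∩R′ (R₂ , Z∩R₂ , R~R₂) with ∈-add2⁻ {p = p} {W} {Z} S∈
    ... | inj₁ S∈p         = inj₁ (R₂ , Z∩R₂ , _◅_ {j = inj₁ (S , S∈p)} (bwd S∩R′) (fwd S∩R ◅ R~R₂))
    ... | inj₂ (inj₁ refl) = inj₂ (R , S∩R , R₂ , Z∩R₂ , R~R₂)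
    ... | inj₂ (inj₂ refl) = inj₁ (R′ , S∩R′ , ε)

    open Propagation LinkedToZ step

    W-node Z-node : Member (add2 p W Z) r
    W-node = inj₁ (W , ∈-add2-A {p = p})
    Z-node = inj₁ (Z , ∈-add2-B {p = p})

    R : Mem r
    R = proj₁ (neighbour (connected₀ Z-node))

    Z∩R : Meets Z (proj₁ R)
    Z∩R = proj₂ (neighbour (connected₀ Z-node))

    R~W : Connected (add2 p W Z) r (inj₂ R) W-node
    R~W = connected₀ (inj₂ R) ◅◅ EqClosure.symmetric _ (connected₀ W-node)

  rearrange : ∀ {p r : Family n} {W A B Z} → (∀ {x} → x ∈ W → x ∈ A ⊎ x ∈ B) →
              (R₀ : Mem r) → (∀ a → Connected (add2 p W Z) r a (inj₂ R₀)) →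
              Bridge p r A Z → add2 p (B ∪ Z) A ∼ r
  rearrange {p} {r} {W} {A} {B} {Z} W⊆A∪B R₀ connected₀ (R₁ , A∩R₁ , R₂ , Z∩R₂ , R₁~R₂) =
    connected⇒∼ (inj₂ R₀) connected₁
    where
    p₀ p₁ : Family n
    p₀ = add2 p W Z
    p₁ = add2 p (B ∪ Z) A

    A-node BZ-node : Member p₁ r
    A-node  = inj₁ (A , ∈-add2-B {p = p})
    BZ-node = inj₁ (B ∪ Z , ∈-add2-A {p = p})

    Z⊆BZ : ∀ {R} → Meets Z R → Meets (B ∪ Z) R
    Z⊆BZ (x , x∈Z , x∈R) = x , q⊆p∪q B Z x∈Z , x∈R

    A~BZ : Connected p₁ r A-node BZ-node
    A~BZ = fwd A∩R₁ ◅ Connected-widen (⊆-add2 {p = p}) R₁~R₂ ◅◅ (bwd (Z⊆BZ Z∩R₂) ◅ ε)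

    W-meeting~BZ : ∀ {R : Mem r} → Meets W (proj₁ R) → Connected p₁ r (inj₂ R) BZ-node
    W-meeting~BZ (x , x∈W , x∈R) with W⊆A∪B x∈W
    ... | inj₁ x∈A = bwd (x , x∈A , x∈R) ◅ A~BZ
    ... | inj₂ x∈B = bwd (x , p⊆p∪q Z x∈B , x∈R) ◅ ε

    co-meeting : ∀ {S} {R R′ : Mem r} → S ∈F p₀ → Meets S (proj₁ R) → Meets S (proj₁ R′) →
                 Connected p₁ r (inj₂ R) (inj₂ R′)
    co-meeting {S} S∈ S∩R S∩R′ with ∈-add2⁻ {p = p} {W} {Z} S∈
    ... | inj₁ S∈p         = _◅_ {j = inj₁ (S , ⊆-add2 {p = p} S∈p)} (bwd S∩R) (fwd S∩R′ ◅ ε)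
    ... | inj₂ (inj₁ refl) = W-meeting~BZ S∩R ◅◅ EqClosure.symmetric _ (W-meeting~BZ S∩R′)
    ... | inj₂ (inj₂ refl) = _◅_ {j = BZ-node} (bwd (Z⊆BZ S∩R)) (fwd (Z⊆BZ S∩R′) ◅ ε)

    ReachesR₀ : Mem r → Set
    ReachesR₀ R = Connected p₁ r (inj₂ R) (inj₂ R₀)

    open Propagation {q = p₀} ReachesR₀ {Done = ⊥}
      (λ S∈ S∩R S∩R′ R~R₀ → inj₁ (co-meeting S∈ S∩R′ S∩R ◅◅ R~R₀))

    reaches : ∀ a → GoodNode a
    reaches a = fromInj₁ ⊥-elim (propagate (EqClosure.symmetric _ (connected₀ a)) ε)

    connected₁ : ∀ a → Connected p₁ r a (inj₂ R₀)
    connected₁ (inj₂ R) = reaches (inj₂ R)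
    connected₁ (inj₁ (S , S∈)) with ∈-add2⁻ {p = p} {B ∪ Z} {A} S∈
    ... | inj₁ S∈p =
      let (R , S∩R , R~R₀) = reaches (inj₁ (S , ⊆-add2 {p = p} {W} {Z} S∈p)) in fwd S∩R ◅ R~R₀
    ... | inj₂ (inj₁ refl) = fwd (Z⊆BZ Z∩R₂) ◅ reaches (inj₂ R₂)
    ... | inj₂ (inj₂ refl) = fwd A∩R₁ ◅ reaches (inj₂ R₁)

lemma8p9 : (n : ℕ) (X Y Z : Subset n) (p : Family n) →
    IsPattern p → IsComplete p →
    (r : Family n) → IsPattern r →
    add2 p (emb (X ∪ Y)) (emb Z) ∼ r →
    (add2 p (emb (Y ∪ Z)) (emb X) ∼ r) ⊎ (add2 p (emb (X ∪ Z)) (emb Y) ∼ r)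
lemma8p9 n X Y Z p (S₀ , S₀∈p , 0∈S₀ , _) _ r (R₀ , R₀∈r , 0∈R₀ , _) p₀∼r =
  ⊎-map (rearrange {p = p} X∪Y⊆X∪Y (R₀ , R₀∈r) connected₀)
        (rearrange {p = p} X∪Y⊆Y∪X (R₀ , R₀∈r) connected₀)
        (Bridge-split X∪Y⊆X∪Y (bridge {p = p} (R₀ , R₀∈r) connected₀))
  where
  p₀ : Family n
  p₀ = add2 p (emb (X ∪ Y)) (emb Z)

  connected₀ : ∀ a → Connected p₀ r a (inj₂ (R₀ , R₀∈r))
  connected₀ = ∼⇒connected (⊆-add2 {p = p} S₀∈p) R₀∈r 0∈S₀ 0∈R₀ p₀∼r

  X∪Y⊆X∪Y : ∀ {x} → x ∈ emb (X ∪ Y) → x ∈ emb X ⊎ x ∈ emb Y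
  X∪Y⊆X∪Y = x∈p∪q⁻ (emb X) (emb Y)

  X∪Y⊆Y∪X : ∀ {x} → x ∈ emb (X ∪ Y) → x ∈ emb Y ⊎ x ∈ emb X
  X∪Y⊆Y∪X = swap ∘ X∪Y⊆X∪Y
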